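{- Let $\mathcal C\subseteq 2^{[n]}$ and $\mathcal D\subseteq 2^{[m]}$ be intersection-complete neural codes. The following are equivalent: (i) $\mathcal C$ covers $\mathcal D$ in $\mathbf{P}_{\mathbf{Code}}$; (ii) $\mathcal C\cong\mathcal D_{[\mathcal I]}$ for some isolated subset $\mathcal I\subseteq\mathcal D$, where $\mathcal D_{[\mathcal I]}=\{\mu\}\cup(\mathcal D\setminus\mathcal I)\cup(\mathcal I)_\alpha$ and $\mu$ is the minimal element of $\mathcal I$.
   Context: A neural code is a set $\mathcal C\subseteq 2^{[n]}$ containing $\varnothing$. For $\sigma\subseteq[n]$, the trunk $\mathrm{Tk}_{\mathcal C}(\sigma)=\{\tau\in\mathcal C:\sigma\subseteq\tau\}$; a trunk is proper if nonempty and not equal to $\mathcal C$. A morphism $f:\mathcal C\to\mathcal D$ is a function such that the preimage of every proper trunk in $\mathcal D$ is a proper trunk in $\mathcal C$; an isomorphism is a bijective morphism whose inverse is a morphism, written $\cong$. Write $\mathcal D\le\mathcal C$ if there is a surjective morphism $\mathcal C\to\mathcal D$; this partial order on isomorphism classes is $\mathbf{P}_{\mathbf{Code}}$, and $\mathcal C$ covers $\mathcal D$ if $\mathcal D<\mathcal C$ with no $\mathcal E$ satisfying $\mathcal D<\mathcal E<\mathcal C$. A code is intersection-complete if closed under pairwise intersection. If $\mathcal D$ is intersection-complete, $\mathcal I\subseteq\mathcal D$ is isolated if it is nonempty and closed under pairwise intersection (so it has a least element $\mu$), and there are no $\sigma\in\mathcal D\setminus\mathcal I$, $\tau\in\mathcal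 I\setminus\{\mu\}$ with $\tau\subseteq\sigma$. Here $\alpha\notin[m]$ is a new neuron and $(S)_\alpha=\{c\cup\{\alpha\}:c\in S\}$. -}

module Defs where

open import Data.Nat using (ℕ; suc)
open import Data.Bool using (Bool; true; false; T; _∧_; _∨_; not)
import Data.Bool.Properties as BoolP
open import Data.Fin using (Fin)
open import Data.Fin.Subset using (Subset; _⊆_; _∩_) renaming (⊥ to ∅)
open import Data.Vec using (_∷_)
open import Data.Vec.Properties using (≡-dec)
open import Data.Product using (Σ; Σ-syntax; ∃; ∃-syntax; _×_; proj₁)
open import Relation.Nullary using (¬_; ⌊_⌋)
open import Relation.Binary.PropositionalEquality using (_≡_)
open import Function.Bundles using (_⇔_)

Code : ℕ → Set
Code n = Subset n → Bool

_∈C_ : ∀ {n} → Subset n → Code n → Set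
c ∈C C = T (C c)

IsNeuralCode : ∀ {n} → Code n → Set
IsNeuralCode C = ∅ ∈C C

El : ∀ {n} → Code n → Set
El {n} C = Σ (Subset n) (λ c → c ∈C C)

-- The trunk Tk_C(σ) is {τ ∈ C : σ ⊆ τ}; it is proper if it is nonempty and not all of C.
ProperTrunk : ∀ {n} (C : Code n) (σ : Subset n) → Set
ProperTrunk C σ = (Σ[ c ∈ El C ] σ ⊆ proj₁ c) × ¬ (∀ (c : El C) → σ ⊆ proj₁ c)

-- f : C → D is a morphism if the preimage of every proper trunk of D is a proper trunk of C.
IsMorphism : ∀ {n m} (C : Code n) (D : Code m) → (El C → El D) → Set
IsMorphism {n} C D f =
  ∀ (σ : Subset _) → ProperTrunk D σ →
    Σ[ σ′ ∈ Subset n ] ((∀ (c : El C) → (σ ⊆ proj₁ (f c)) ⇔ (σ′ ⊆ proj₁ c)) × ProperTrunk C σ′)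

_≅_ : ∀ {n m} → Code n → Code m → Set
C ≅ D = Σ[ f ∈ (El C → El D) ] Σ[ g ∈ (El D → El C) ]
          IsMorphism C D f × IsMorphism D C g ×
          (∀ c → g (f c) ≡ c) × (∀ d → f (g d) ≡ d)

_≤C_ : ∀ {m n} → Code m → Code n → Set
D ≤C C = Σ[ f ∈ (El C → El D) ] IsMorphism C D f × (∀ d → ∃[ c ] f c ≡ d)

_<C_ : ∀ {m n} → Code m → Code n → Set
D <C C = (D ≤C C) × ¬ (D ≅ C)

Covers : ∀ {n m} → Code n → Code m → Set
Covers C D = (D <C C) ×
  (∀ (k : ℕ) (E : Code k) → IsNeuralCode E → ¬ ((D <C E) × (E <C C)))

IntersectionComplete : ∀ {n} → Code n → Set
IntersectionComplete C = ∀ c d → c ∈C C → d ∈C C → (c ∩ d) ∈C C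

record Isolated {m} (D : Code m) (I : Code m) (μ : Subset m) : Set where
  field
    I⊆D       : ∀ c → c ∈C I → c ∈C D
    μ∈I       : μ ∈C I
    ∩-closed  : ∀ c d → c ∈C I → d ∈C I → (c ∩ d) ∈C I
    μ-least   : ∀ c → c ∈C I → μ ⊆ c
    isolation : ∀ σ τ → σ ∈C D → ¬ (σ ∈C I) → τ ∈C I → ¬ (τ ≡ μ) → ¬ (τ ⊆ σ)

_==_ : ∀ {m} → Subset m → Subset m → Bool
c == d = ⌊ ≡-dec BoolP._≟_ c d ⌋

-- D_[I] = {μ} ∪ (D \ I) ∪ (I)_α on m+1 neurons, the new neuron α being index zero:
-- a codeword (false ∷ c) is c (no α), (true ∷ c) is c ∪ {α}.
Split : ∀ {m} → Code m → Code m → Subset m → Code (suc m)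
Split D I μ (false ∷ c) = (c == μ) ∨ (D c ∧ not (I c))
Split D I μ (true ∷ c)  = I c

-- A surjective morphism f : C → D out of an intersection-complete code has a left adjoint
-- φ : D → C for inclusion (φ d ⊆ c ⇔ d ⊆ f c): φ d is the least codeword of the pullback of the
-- trunk of d. So φ embeds D into C, and f is an isomorphism as soon as φ is onto.
--
-- If C ≅ D_[I], then C has exactly one codeword more than D. Given D < E < C, the embedding of D
-- into C along C → E → D misses a single codeword x; if the trunk of x is a pullback along C → E
-- then C ≅ E, and otherwise E ≅ D.
--
-- Conversely, if C covers D via f, pick a codeword x maximal outside the image of φ and put
-- μ = f x and I = f(↑x). Every codeword strictly above x lies in the image of φ, which makes I
-- isolated. Adding the neuron α on ↑x gives a surjective morphism q : C → D_[I] whose left adjoint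
-- sends μ ∪ {α} to x; since D < D_[I] ≤ C, the covering forces that adjoint to be onto, so
-- C ≅ D_[I].

module Submission where

open import Defs
open import Data.Nat using (zero; suc; _+_)
import Data.Nat.Properties as ℕ
open import Data.Bool using (true; false; T; not)
open import Data.Bool.Properties as Bool using (T?)
open import Data.Fin using (Fin)
import Data.Fin.Properties as Fin
open import Data.Fin.Subset using (Subset; _⊆_; _⊂_; _∩_; inside; outside) renaming (⊥ to ∅)
open import Data.Fin.Subset.Properties
  using ( _⊆?_; _⊂?_; ⊆-refl; ⊆-trans; ⊆-antisym; ⊆-min; p∩q⊆p; p∩q⊆q; x∈p∩q⁺; ∩-comm
        ; drop-∷-⊆; s⊆s; s⊂s; out⊂in; out⊆-⇔; in⊆in; in⊆in-⇔ )
open import Data.Fin.Subset.Induction using (⊂-wellFounded; ⊃-wellFounded)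
open import Data.Vec using ([]; _∷_; here)
open import Data.Vec.Properties using (≡-dec)
open import Data.Product using (Σ-syntax; ∃; ∃-syntax; _×_; _,_; proj₁; proj₂)
open import Data.Sum using (_⊎_; inj₁; inj₂; [_,_])
open import Data.Sum.Function.Propositional using (_⊎-↔_; _⊎-⇔_)
open import Data.Product.Function.NonDependent.Propositional using (_×-⇔_)
open import Data.Unit using (⊤; tt)
open import Data.Empty using (⊥; ⊥-elim)
open import Function using (_∘_; id; const; flip)
open import Function.Bundles using (_↔_; _↣_; _⇔_; mk↔ₛ′; mk↣; mk⇔; Inverse; Injection; Equivalence)
open import Function.Definitions using (Injective; StrictlySurjective)
import Function.Properties.Equivalence as ⇔
open import Function.Construct.Composition using (_↣-∘_)
open import Function.Properties.Inverse using (↔-sym; ↔-trans; ↔⇒↣)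
open import Induction.WellFounded using (WellFounded; Acc; acc)
open import Level using (0ℓ)
open import Relation.Binary using (Rel; Decidable; DecidableEquality)
open import Relation.Binary.PropositionalEquality
  using (_≡_; _≢_; refl; sym; trans; cong; cong₂; subst; module ≡-Reasoning)
open import Relation.Nullary using (¬_; Dec; yes; no; ¬?; does; ⌊_⌋)
open import Relation.Nullary.Decidable
  using (_×-dec_; map′; toWitness; fromWitness; dec-true; dec-false; decidable-stable; ¬¬-excluded-middle)

T-not⇔¬T : ∀ {b} → T (not b) ⇔ (¬ T b)
T-not⇔¬T {false} = mk⇔ (λ _ ()) (λ _ → tt)
T-not⇔¬T {true}  = mk⇔ (λ ()) (λ ¬t → ¬t tt)

_≟ˢ_ : ∀ {n} → DecidableEquality (Subset n)
_≟ˢ_ = ≡-dec Bool._≟_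

⊆-∩ : ∀ {n} {p q r : Subset n} → p ⊆ q → p ⊆ r → p ⊆ q ∩ r
⊆-∩ p⊆q p⊆r x∈p = x∈p∩q⁺ (p⊆q x∈p , p⊆r x∈p)

⊆⇒∩≡ˡ : ∀ {n} {p q : Subset n} → p ⊆ q → p ∩ q ≡ p
⊆⇒∩≡ˡ p⊆q = ⊆-antisym (p∩q⊆p _ _) (⊆-∩ ⊆-refl p⊆q)

⊆⇒∩≡ʳ : ∀ {n} {p q : Subset n} → q ⊆ p → p ∩ q ≡ q
⊆⇒∩≡ʳ q⊆p = ⊆-antisym (p∩q⊆q _ _) (⊆-∩ q⊆p ⊆-refl)

⊆∧⊉⇒⊂ : ∀ {n} {p q : Subset n} → p ⊆ q → ¬ (q ⊆ p) → p ⊂ q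
⊆∧⊉⇒⊂ {p = []}          {[]}          _   q⊈p = ⊥-elim (q⊈p ⊆-refl)
⊆∧⊉⇒⊂ {p = inside  ∷ p} {outside ∷ q} p⊆q _   with p⊆q here
... | ()
⊆∧⊉⇒⊂ {p = outside ∷ p} {inside  ∷ q} p⊆q _   = out⊂in (drop-∷-⊆ p⊆q)
⊆∧⊉⇒⊂ {p = outside ∷ p} {outside ∷ q} p⊆q q⊈p = s⊂s (⊆∧⊉⇒⊂ (drop-∷-⊆ p⊆q) (q⊈p ∘ s⊆s))
⊆∧⊉⇒⊂ {p = inside  ∷ p} {inside  ∷ q} p⊆q q⊈p = s⊂s (⊆∧⊉⇒⊂ (drop-∷-⊆ p⊆q) (q⊈p ∘ s⊆s))

¬in⊆out : ∀ {n} {p q : Subset n} → ¬ (true ∷ p ⊆ false ∷ q)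
¬in⊆out p⊆q with p⊆q here
... | ()

module _ {n k} {p q : Subset n} {r s : Subset k} where

  both-⊆⇔ : p ⊆ q → r ⊆ s → (p ⊆ q) ⇔ (r ⊆ s)
  both-⊆⇔ p⊆q r⊆s = mk⇔ (λ _ {_} → r⊆s) (λ _ {_} → p⊆q)

  neither-⊆⇔ : ¬ (p ⊆ q) → ¬ (r ⊆ s) → (p ⊆ q) ⇔ (r ⊆ s)
  neither-⊆⇔ p⊈q r⊈s = mk⇔ (⊥-elim ∘ p⊈q) (⊥-elim ∘ r⊈s)

Finite : Set → Set
Finite A = ∃[ k ] (A ↔ Fin k)

Finite-⊎ : ∀ {A B} → Finite A → Finite B → Finite (A ⊎ B)
Finite-⊎ (k , e) (l , f) = k + l , ↔-trans (e ⊎-↔ f) (↔-sym Fin.+↔⊎)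

⊤-finite : Finite ⊤
⊤-finite = 1 , ↔-sym Fin.1↔⊤

T-finite : ∀ b → Finite (T b)
T-finite false = 0 , ↔-sym Fin.0↔⊥
T-finite true  = ⊤-finite

module _ {A : Set} (A-finite : Finite A) where
  private
    k = proj₁ A-finite
    e = proj₂ A-finite
  open Inverse e

  any? : {P : A → Set} → (∀ a → Dec (P a)) → Dec (∃ P)
  any? {P} P? = map′ (λ (i , p) → from i , p) (λ (a , p) → to a , subst P (sym (strictlyInverseʳ a)) p)
                     (Fin.any? (P? ∘ from))

  counterexample-or-all : {P : A → Set} → (∀ a → Dec (P a)) → (∃ λ a → ¬ P a) ⊎ (∀ a → P a)
  counterexample-or-all P? with any? (¬? ∘ P?)
  ... | yes c = inj₁ c
  ... | no ∄c = inj₂ λ a → decidable-stable (P? a) (λ ¬p → ∄c (a , ¬p))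

  ⊎⊤↣⇒⊥ : (A ⊎ ⊤) ↣ A → ⊥
  ⊎⊤↣⇒⊥ ι = ℕ.m+1+n≰m k (Fin.injective⇒≤ (Injection.injective fin↣))
    where
    fin↣ : Fin (k + 1) ↣ Fin k
    fin↣ = ↔⇒↣ e ↣-∘ (ι ↣-∘ ↔⇒↣ (↔-trans Fin.+↔⊎ (↔-sym e ⊎-↔ Fin.1↔⊤)))

extend↣ : ∀ {A B : Set} (f : A ↣ B) (b : B) → (∀ a → Injection.to f a ≢ b) → (A ⊎ ⊤) ↣ B
extend↣ {A} {B} f b b∉f = mk↣ {to = g} g-injective
  where
  g : A ⊎ ⊤ → B
  g = [ Injection.to f , const b ]
  g-injective : ∀ {u v} → g u ≡ g v → u ≡ v
  g-injective {inj₁ a} {inj₁ a′} eq = cong inj₁ (Injection.injective f eq)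
  g-injective {inj₁ a} {inj₂ _}  eq = ⊥-elim (b∉f a eq)
  g-injective {inj₂ _} {inj₁ a′} eq = ⊥-elim (b∉f a′ (sym eq))
  g-injective {inj₂ _} {inj₂ _}  eq = refl

module _ {n} {C : Code n} where

  El-≡ : {a b : El C} → proj₁ a ≡ proj₁ b → a ≡ b
  El-≡ {a , p} {.a , q} refl = cong (a ,_) (Bool.T-irrelevant p q)

  _≟El_ : DecidableEquality (El C)
  a ≟El b = map′ El-≡ (cong proj₁) (proj₁ a ≟ˢ proj₁ b)

El-zero↔ : (C : Code 0) → El C ↔ T (C [])
El-zero↔ C = mk↔ₛ′ (λ { ([] , p) → p }) ([] ,_) (λ _ → refl) (λ { ([] , p) → refl })

El-suc↔ : ∀ {n} (C : Code (suc n)) → El C ↔ (El (C ∘ (false ∷_)) ⊎ El (C ∘ (true ∷_)))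
El-suc↔ C = mk↔ₛ′ split join join-split split-join
  where
  split : El C → El (C ∘ (false ∷_)) ⊎ El (C ∘ (true ∷_))
  split (false ∷ c , p) = inj₁ (c , p)
  split (true  ∷ c , p) = inj₂ (c , p)
  join : El (C ∘ (false ∷_)) ⊎ El (C ∘ (true ∷_)) → El C
  join (inj₁ (c , p)) = false ∷ c , p
  join (inj₂ (c , p)) = true  ∷ c , p
  join-split : ∀ w → split (join w) ≡ w
  join-split (inj₁ _) = refl
  join-split (inj₂ _) = refl
  split-join : ∀ c → join (split c) ≡ c
  split-join (false ∷ _ , _) = refl
  split-join (true  ∷ _ , _) = refl

El-finite : ∀ {n} (C : Code n) → Finite (El C)
El-finite {zero} C with T-finite (C [])
... | k , e = k , ↔-trans (El-zero↔ C) e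
El-finite {suc n} C with Finite-⊎ (El-finite (C ∘ (false ∷_))) (El-finite (C ∘ (true ∷_)))
... | k , e = k , ↔-trans (El-suc↔ C) e

module _ {n} {C : Code n} {_≺_ : Rel (Subset n) 0ℓ} (≺-wf : WellFounded _≺_) (_≺?_ : Decidable _≺_)
         {P : El C → Set} (P? : ∀ c → Dec (P c)) where

  minimal : ∀ c → P c → Σ[ c₀ ∈ El C ] (P c₀ × ∀ d → P d → ¬ (proj₁ d ≺ proj₁ c₀))
  minimal c Pc = go c Pc (≺-wf (proj₁ c))
    where
    go : ∀ c → P c → Acc _≺_ (proj₁ c) →
         Σ[ c₀ ∈ El C ] (P c₀ × ∀ d → P d → ¬ (proj₁ d ≺ proj₁ c₀))
    go c Pc (acc below) with any? (El-finite C) (λ d → P? d ×-dec (proj₁ d ≺? proj₁ c))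
    ... | yes (d , Pd , d≺c) = go d Pd (below d≺c)
    ... | no ∄d = c , Pc , λ d Pd d≺c → ∄d (d , Pd , d≺c)

-- Trunks and pullbacks

-- f⁻¹ Tk(τ) = Tk(σ); for f = id this says that τ and σ have the same trunk.
Pullback : ∀ {n m} {C : Code n} {D : Code m} → (El C → El D) → Subset m → Subset n → Set
Pullback {C = C} f τ σ = ∀ (c : El C) → (τ ⊆ proj₁ (f c)) ⇔ (σ ⊆ proj₁ c)

module _ {n m k} {C : Code n} {D : Code m} {E : Code k} {f : El C → El D} {g : El D → El E}
         {ρ : Subset n} {σ : Subset m} {τ : Subset k} where

  pullback-∘ : Pullback g τ σ → Pullback f σ ρ → Pullback (g ∘ f) τ ρ
  pullback-∘ g* f* c = ⇔.trans (g* (f c)) (f* c)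

  pullback-cancelˡ : Pullback g τ σ → Pullback (g ∘ f) τ ρ → Pullback f σ ρ
  pullback-cancelˡ g* gf* c = ⇔.trans (⇔.sym (g* (f c))) (gf* c)

  pullback-cancelʳ : StrictlySurjective _≡_ f → Pullback (g ∘ f) τ ρ → Pullback f σ ρ → Pullback g τ σ
  pullback-cancelʳ f-onto gf* f* d with f-onto d
  ... | c , refl = ⇔.trans (gf* c) (⇔.sym (f* c))

pullback-id-sym : ∀ {n} {C : Code n} {σ τ : Subset n} → Pullback {C = C} id σ τ → Pullback {C = C} id τ σ
pullback-id-sym p c = ⇔.sym (p c)

module _ {n m} {C : Code n} {D : Code m} {f : El C → El D} {τ : Subset m} {σ : Subset n} where
  open Equivalence

  properTrunk-pullback : Pullback f τ σ → ProperTrunk C σ → ProperTrunk D τ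
  properTrunk-pullback f* ((c , σ⊆c) , not-all) =
    (f c , from (f* c) σ⊆c) , λ all → not-all (λ c′ → to (f* c′) (all (f c′)))

  properTrunk-pullback⁻ : StrictlySurjective _≡_ f → Pullback f τ σ → ProperTrunk D τ → ProperTrunk C σ
  properTrunk-pullback⁻ f-onto f* ((d , τ⊆d) , not-all) with f-onto d
  ... | c , refl = (c , to (f* c) τ⊆d) , λ all → not-all (λ d′ → τ⊆ d′ (f-onto d′) all)
    where
    τ⊆ : ∀ d′ → ∃[ c′ ] f c′ ≡ d′ → (∀ c′ → σ ⊆ proj₁ c′) → τ ⊆ proj₁ d′
    τ⊆ d′ (c′ , refl) all = from (f* c′) (all c′)

∘-isMorphism : ∀ {n m k} {C : Code n} {D : Code m} {E : Code k} {f : El C → El D} {g : El D → El E} →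
               IsMorphism C D f → IsMorphism D E g → IsMorphism C E (g ∘ f)
∘-isMorphism {f = f} {g} f-mor g-mor τ τ-proper with g-mor τ τ-proper
... | σ , g* , σ-proper with f-mor σ σ-proper
... | ρ , f* , ρ-proper = ρ , pullback-∘ {f = f} {g} g* f* , ρ-proper

∘-strictlySurjective : ∀ {A B X : Set} {f : A → B} {g : B → X} →
                       StrictlySurjective _≡_ f → StrictlySurjective _≡_ g → StrictlySurjective _≡_ (g ∘ f)
∘-strictlySurjective f-onto g-onto x with g-onto x
... | b , refl with f-onto b
... | a , refl = a , refl

≅-sym : ∀ {n m} {C : Code n} {D : Code m} → C ≅ D → D ≅ C
≅-sym (f , g , f-mor , g-mor , g∘f , f∘g) = g , f , g-mor , f-mor , f∘g , g∘f

≅⇒↔ : ∀ {n m} {C : Code n} {D : Code m} → C ≅ D → El C ↔ El D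
≅⇒↔ (f , g , _ , _ , g∘f , f∘g) = mk↔ₛ′ f g f∘g g∘f

≤C-respʳ-≅ : ∀ {n m k} {C : Code n} {S : Code k} {D : Code m} → C ≅ S → D ≤C S → D ≤C C
≤C-respʳ-≅ (F , G , F-mor , _ , _ , F∘G) (π , π-mor , π-onto) =
  π ∘ F , ∘-isMorphism {f = F} {π} F-mor π-mor ,
  ∘-strictlySurjective {f = F} {π} (λ s → G s , F∘G s) π-onto

codeword-pullback : ∀ {n m} {C : Code n} {D : Code m} {f : El C → El D} →
                    IsMorphism C D f → (d : El D) → ∃[ σ ] Pullback f (proj₁ d) σ
codeword-pullback {D = D} {f} f-mor d
  with counterexample-or-all (El-finite D) (λ d′ → proj₁ d ⊆? proj₁ d′)
... | inj₁ (d′ , d⊈d′) =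
  let σ , f* , _ = f-mor (proj₁ d) ((d , ⊆-refl) , λ all → d⊈d′ (all d′)) in σ , f*
... | inj₂ all = ∅ , λ c → both-⊆⇔ (all (f c)) (⊆-min _)

trunk-least : ∀ {n} {C : Code n} → IntersectionComplete C → ∀ {σ} (c : El C) → σ ⊆ proj₁ c →
              Σ[ ĉ ∈ El C ] Pullback {C = C} id σ (proj₁ ĉ)
trunk-least {C = C} ic {σ} c σ⊆c with minimal ⊂-wellFounded _⊂?_ (λ c → σ ⊆? proj₁ c) c σ⊆c
... | ĉ , σ⊆ĉ , ĉ-minimal = ĉ , λ c′ → mk⇔ (ĉ⊆ c′) (⊆-trans σ⊆ĉ)
  where
  ĉ⊆ : ∀ c′ → σ ⊆ proj₁ c′ → proj₁ ĉ ⊆ proj₁ c′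
  ĉ⊆ c′ σ⊆c′ with proj₁ ĉ ⊆? proj₁ c′
  ... | yes ĉ⊆c′ = ĉ⊆c′
  ... | no ĉ⊈c′ = ⊥-elim (ĉ-minimal (_ , ic _ _ (proj₂ ĉ) (proj₂ c′)) (⊆-∩ σ⊆ĉ σ⊆c′)
                   (⊆∧⊉⇒⊂ (p∩q⊆p _ _) (λ ĉ⊆ĉ∩c′ → ĉ⊈c′ (⊆-trans ĉ⊆ĉ∩c′ (p∩q⊆q _ _)))))

ReflectsTrunks : ∀ {n m} {C : Code n} {D : Code m} → (El C → El D) → Set
ReflectsTrunks {C = C} f = ∀ σ → ProperTrunk C σ → ∃[ τ ] Pullback f τ σ

reflectsTrunks : ∀ {n m} {C : Code n} {D : Code m} {f : El C → El D} → IntersectionComplete C →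
                 (∀ c → ∃[ τ ] Pullback f τ (proj₁ c)) → ReflectsTrunks f
reflectsTrunks {f = f} ic f* σ ((c , σ⊆c) , _) with trunk-least ic c σ⊆c
... | ĉ , σ≐ĉ with f* ĉ
... | τ , τ* = τ , pullback-∘ {f = id} {f} τ* (pullback-id-sym σ≐ĉ)

module _ {n m} {C : Code n} {D : Code m} {f : El C → El D} where
  open Equivalence

  reflectsTrunks⇒injective : ReflectsTrunks f → Injective _≡_ _≡_ f
  reflectsTrunks⇒injective f* fa≡fb = El-≡ (⊆-antisym (⊆-if-≡ fa≡fb) (⊆-if-≡ (sym fa≡fb)))
    where
    ⊆-if-≡ : ∀ {a b} → f a ≡ f b → proj₁ a ⊆ proj₁ b
    ⊆-if-≡ {a} {b} fa≡fb with proj₁ a ⊆? proj₁ b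
    ... | yes a⊆b = a⊆b
    ... | no a⊈b with f* (proj₁ a) ((a , ⊆-refl) , λ all → a⊈b (all b))
    ... | τ , τ* = to (τ* b) (subst (λ d → τ ⊆ proj₁ d) fa≡fb (from (τ* a) ⊆-refl))

  ≅-from-reflecting : IsMorphism C D f → StrictlySurjective _≡_ f → ReflectsTrunks f → C ≅ D
  ≅-from-reflecting f-mor f-onto f* = f , g , f-mor , g-mor , g∘f , f∘g
    where
    g : El D → El C
    g d = proj₁ (f-onto d)
    f∘g : ∀ d → f (g d) ≡ d
    f∘g d = proj₂ (f-onto d)
    g∘f : ∀ c → g (f c) ≡ c
    g∘f c = reflectsTrunks⇒injective f* (f∘g (f c))
    g-mor : IsMorphism D C g
    g-mor σ σ-proper with f* σ σ-proper
    ... | τ , τ* = τ , g* , properTrunk-pullback {f = f} τ* σ-proper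
      where
      g* : Pullback g σ τ
      g* d = subst (λ d′ → (σ ⊆ proj₁ (g d)) ⇔ (τ ⊆ proj₁ d′)) (f∘g d) (⇔.sym (τ* (g d)))

-- Left adjoints of surjective morphisms

record LeftAdjoint {n m} {C : Code n} {D : Code m} (f : El C → El D) : Set where
  field
    φ            : El D → El C
    adjoint      : ∀ d → Pullback f (proj₁ d) (proj₁ (φ d))
    f-surjective : StrictlySurjective _≡_ f

module _ {n m} {C : Code n} {D : Code m} {f : El C → El D} (L : LeftAdjoint f) where
  open LeftAdjoint L
  open Equivalence

  φ∘f⊆ : ∀ c → proj₁ (φ (f c)) ⊆ proj₁ c
  φ∘f⊆ c = to (adjoint (f c) c) ⊆-refl

  f-mono : ∀ {c c′} → proj₁ c ⊆ proj₁ c′ → proj₁ (f c) ⊆ proj₁ (f c′)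
  f-mono {c} {c′} c⊆c′ = from (adjoint (f c) c′) (⊆-trans (φ∘f⊆ c) c⊆c′)

  f∘φ : ∀ d → f (φ d) ≡ d
  f∘φ d with f-surjective d
  ... | c , refl = El-≡ (⊆-antisym (f-mono (φ∘f⊆ c)) (from (adjoint (f c) (φ (f c))) ⊆-refl))

  φ-injective : Injective _≡_ _≡_ φ
  φ-injective {d} {d′} φd≡φd′ = begin
    d         ≡⟨ f∘φ d ⟨
    f (φ d)   ≡⟨ cong f φd≡φd′ ⟩
    f (φ d′)  ≡⟨ f∘φ d′ ⟩
    d′        ∎
    where open ≡-Reasoning

  φ↣ : El D ↣ El C
  φ↣ = mk↣ φ-injective

  φ-mono : ∀ {d d′} → proj₁ d ⊆ proj₁ d′ → proj₁ (φ d) ⊆ proj₁ (φ d′)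
  φ-mono {d} {d′} d⊆d′ =
    to (adjoint d (φ d′)) (subst (λ d″ → proj₁ d ⊆ proj₁ d″) (sym (f∘φ d′)) d⊆d′)

  f-isMorphism : IntersectionComplete D → IsMorphism C D f
  f-isMorphism icD τ τ-proper@((d , τ⊆d) , _) with trunk-least icD d τ⊆d
  ... | d̂ , τ≐d̂ = proj₁ (φ d̂) , f* , properTrunk-pullback⁻ {f = f} f-surjective f* τ-proper
    where
    f* : Pullback f τ (proj₁ (φ d̂))
    f* = pullback-∘ {f = f} {id} τ≐d̂ (adjoint d̂)

  Image : El C → Set
  Image c = ∃[ d ] φ d ≡ c

  image? : ∀ c → Dec (Image c)
  image? c = any? (El-finite D) (λ d → φ d ≟El c)

  image⇒φ∘f : ∀ {c} → Image c → φ (f c) ≡ c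
  image⇒φ∘f (d , refl) = cong φ (f∘φ d)

  ¬image⇒≇ : ∀ {c} → ¬ Image c → ¬ (D ≅ C)
  ¬image⇒≇ {c} c∉φ D≅C =
    ⊎⊤↣⇒⊥ (El-finite D) (↔⇒↣ (≅⇒↔ (≅-sym D≅C)) ↣-∘ extend↣ φ↣ c (λ d φd≡c → c∉φ (d , φd≡c)))

  onto-or-maximal-outside :
    (∀ c → Image c) ⊎ Σ[ x ∈ El C ] (¬ Image x × ∀ y → ¬ Image y → ¬ (proj₁ x ⊂ proj₁ y))
  onto-or-maximal-outside with counterexample-or-all (El-finite C) image?
  ... | inj₂ φ-onto = inj₁ φ-onto
  ... | inj₁ (x₀ , x₀∉φ) = inj₂ (minimal ⊃-wellFounded (flip _⊂?_) (¬? ∘ image?) x₀ x₀∉φ)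

  ⊆φ⇒f⊆ : ∀ {c d} → proj₁ c ⊆ proj₁ (φ d) → proj₁ (f c) ⊆ proj₁ d
  ⊆φ⇒f⊆ {c} {d} c⊆φd = subst (λ d′ → proj₁ (f c) ⊆ proj₁ d′) (f∘φ d) (f-mono c⊆φd)

  f-∩ : IntersectionComplete D → ∀ {d d′} (z : El C) → proj₁ z ≡ proj₁ (φ d) ∩ proj₁ (φ d′) →
        proj₁ (f z) ≡ proj₁ d ∩ proj₁ d′
  f-∩ icD {d} {d′} z refl = ⊆-antisym (⊆-∩ (⊆φ⇒f⊆ (p∩q⊆p _ _)) (⊆φ⇒f⊆ (p∩q⊆q _ _)))
    (from (adjoint d∩d′ z) (⊆-∩ (φ-mono (p∩q⊆p _ _)) (φ-mono (p∩q⊆q _ _))))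
    where
    d∩d′ : El D
    d∩d′ = proj₁ d ∩ proj₁ d′ , icD _ _ (proj₂ d) (proj₂ d′)

  φ-onto⇒↔ : (∀ c → Image c) → El C ↔ El D
  φ-onto⇒↔ φ-onto = mk↔ₛ′ f φ f∘φ (image⇒φ∘f ∘ φ-onto)

  φ-onto⇒≅ : IsMorphism C D f → IntersectionComplete C → (∀ c → Image c) → C ≅ D
  φ-onto⇒≅ f-mor icC φ-onto = ≅-from-reflecting f-mor f-surjective (reflectsTrunks {f = f} icC f*)
    where
    f* : ∀ c → ∃[ τ ] Pullback f τ (proj₁ c)
    f* c with φ-onto c
    ... | d , refl = proj₁ d , adjoint d

leftAdjoint : ∀ {n m} {C : Code n} {D : Code m} {f : El C → El D} →
              IntersectionComplete C → IsMorphism C D f → StrictlySurjective _≡_ f → LeftAdjoint f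
leftAdjoint {C = C} {D} {f} icC f-mor f-onto = record
  { φ = proj₁ ∘ generator ; adjoint = proj₂ ∘ generator ; f-surjective = f-onto }
  where
  open Equivalence
  generator : ∀ d → Σ[ ĉ ∈ El C ] Pullback f (proj₁ d) (proj₁ ĉ)
  generator d with codeword-pullback {f = f} f-mor d | f-onto d
  ... | σ , σ* | c , refl with trunk-least icC c (to (σ* c) ⊆-refl)
  ... | ĉ , σ≐ĉ = ĉ , pullback-∘ {f = id} {f} σ* σ≐ĉ

-- Split codes

¬≅-if-one-more : ∀ {n m} {C : Code n} {D : Code m} → El C ↔ (El D ⊎ ⊤) → ¬ (D ≅ C)
¬≅-if-one-more C↔D⊤ D≅C =
  ⊎⊤↣⇒⊥ (El-finite _) (↔⇒↣ (≅⇒↔ (≅-sym D≅C)) ↣-∘ ↔⇒↣ (↔-sym C↔D⊤))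

module SplitCode {m} {D I : Code m} {μ : Subset m} (isolated : Isolated D I μ) where
  open Isolated isolated
  open Equivalence

  S : Code (suc m)
  S = Split D I μ

  split-false⇔ : ∀ {c} → (false ∷ c) ∈C S ⇔ (c ≡ μ ⊎ (c ∈C D × ¬ c ∈C I))
  split-false⇔ =
    ⇔.trans Bool.T-∨ (mk⇔ toWitness fromWitness ⊎-⇔ ⇔.trans Bool.T-∧ (⇔.refl ×-⇔ T-not⇔¬T))

  π : El S → El D
  π (false ∷ c , p) = c , [ (λ { refl → I⊆D μ μ∈I }) , proj₁ ] (to split-false⇔ p)
  π (true  ∷ c , p) = c , I⊆D c p

  lift : El D → El S
  lift (c , p) with T? (I c)
  ... | yes c∈I = true ∷ c , c∈I
  ... | no  c∉I = false ∷ c , from split-false⇔ (inj₂ (p , c∉I))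

  π∘lift : ∀ d → π (lift d) ≡ d
  π∘lift (c , p) with T? (I c)
  ... | yes _ = El-≡ refl
  ... | no  _ = El-≡ refl

  lift≢μ : ∀ d → proj₁ (lift d) ≢ false ∷ μ
  lift≢μ (c , p) with T? (I c)
  ... | yes _   = λ ()
  ... | no  c∉I = λ { refl → c∉I μ∈I }

  lift∘π : ∀ w → proj₁ w ≢ false ∷ μ → lift (π w) ≡ w
  lift∘π (true ∷ c , p) _ with T? (I c)
  ... | yes _   = El-≡ refl
  ... | no  c∉I = ⊥-elim (c∉I p)
  lift∘π (false ∷ c , p) w≢μ with T? (I c) | to split-false⇔ p
  ... | no  _   | _                = El-≡ refl
  ... | yes _   | inj₁ refl        = ⊥-elim (w≢μ refl)
  ... | yes c∈I | inj₂ (_ , c∉I)   = ⊥-elim (c∉I c∈I)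

  π-surjective : StrictlySurjective _≡_ π
  π-surjective d = lift d , π∘lift d

  π-pullback : ∀ τ → Pullback π τ (false ∷ τ)
  π-pullback τ (false ∷ _ , _) = out⊆-⇔
  π-pullback τ (true  ∷ _ , _) = out⊆-⇔

  π-isMorphism : IsMorphism S D π
  π-isMorphism τ τ-proper =
    false ∷ τ , π-pullback τ , properTrunk-pullback⁻ {f = π} π-surjective (π-pullback τ) τ-proper

  D≤S : D ≤C S
  D≤S = π , π-isMorphism , π-surjective

  El-Split↔ : El S ↔ (El D ⊎ ⊤)
  El-Split↔ = mk↔ₛ′ forget add forget∘add add∘forget
    where
    μ̂ : El S
    μ̂ = false ∷ μ , from split-false⇔ (inj₁ refl)
    forget : El S → El D ⊎ ⊤
    forget w with proj₁ w ≟ˢ (false ∷ μ)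
    ... | yes _ = inj₂ tt
    ... | no  _ = inj₁ (π w)
    add : El D ⊎ ⊤ → El S
    add = [ lift , const μ̂ ]
    forget∘add : ∀ u → forget (add u) ≡ u
    forget∘add (inj₁ d) with proj₁ (lift d) ≟ˢ (false ∷ μ)
    ... | yes eq = ⊥-elim (lift≢μ d eq)
    ... | no  _  = cong inj₁ (π∘lift d)
    forget∘add (inj₂ tt) with (false ∷ μ) ≟ˢ (false ∷ μ)
    ... | yes _  = refl
    ... | no neq = ⊥-elim (neq refl)
    add∘forget : ∀ w → add (forget w) ≡ w
    add∘forget w with proj₁ w ≟ˢ (false ∷ μ)
    ... | yes eq = El-≡ (sym eq)
    ... | no neq = lift∘π w neq

  D<S : D <C S
  D<S = D≤S , ¬≅-if-one-more El-Split↔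

  module _ (icD : IntersectionComplete D) where

    ∩-split-false : ∀ {c₁ c₂} → c₁ ∈C D → (false ∷ c₂) ∈C S → (false ∷ (c₁ ∩ c₂)) ∈C S
    ∩-split-false {c₁} {c₂} c₁∈D p = from split-false⇔ (meet (T? (I (c₁ ∩ c₂))) (to split-false⇔ p))
      where
      c₁∩c₂∈D : (c₁ ∩ c₂) ∈C D
      c₁∩c₂∈D = icD c₁ c₂ c₁∈D (proj₂ (π (false ∷ c₂ , p)))
      meet : Dec ((c₁ ∩ c₂) ∈C I) → c₂ ≡ μ ⊎ (c₂ ∈C D × ¬ c₂ ∈C I) →
             c₁ ∩ c₂ ≡ μ ⊎ ((c₁ ∩ c₂) ∈C D × ¬ (c₁ ∩ c₂) ∈C I)
      meet (no ∉I) _ = inj₂ (c₁∩c₂∈D , ∉I)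
      meet (yes ∈I) (inj₁ refl) = inj₁ (⊆-antisym (p∩q⊆q c₁ μ) (μ-least _ ∈I))
      meet (yes ∈I) (inj₂ (c₂∈D , c₂∉I)) with (c₁ ∩ c₂) ≟ˢ μ
      ... | yes eq = inj₁ eq
      ... | no neq = ⊥-elim (isolation c₂ (c₁ ∩ c₂) c₂∈D c₂∉I ∈I neq (p∩q⊆q c₁ c₂))

    split-intersectionComplete : IntersectionComplete S
    split-intersectionComplete (true  ∷ c₁) (true  ∷ c₂) p₁ p₂ = ∩-closed c₁ c₂ p₁ p₂
    split-intersectionComplete (true  ∷ c₁) (false ∷ c₂) p₁ p₂ = ∩-split-false (I⊆D c₁ p₁) p₂
    split-intersectionComplete (false ∷ c₁) (true  ∷ c₂) p₁ p₂ =
      subst (λ c → (false ∷ c) ∈C S) (∩-comm c₂ c₁) (∩-split-false (I⊆D c₂ p₂) p₁)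
    split-intersectionComplete (false ∷ c₁) (false ∷ c₂) p₁ p₂ =
      ∩-split-false (proj₂ (π (false ∷ c₁ , p₁))) p₂

  split-neural : IsNeuralCode D → IsNeuralCode S
  split-neural ∅∈D with T? (I ∅)
  ... | yes ∅∈I = from split-false⇔ (inj₁ (⊆-antisym (⊆-min μ) (μ-least ∅ ∅∈I)))
  ... | no  ∅∉I = from split-false⇔ (inj₂ (∅∈D , ∅∉I))

-- Split codes are covers

module _ {n m k} {C : Code n} {D : Code m} {E : Code k}
         (icC : IntersectionComplete C) (C↔D⊤ : El C ↔ (El D ⊎ ⊤))
         {g : El C → El E} {h : El E → El D}
         (g-mor : IsMorphism C E g) (g-onto : StrictlySurjective _≡_ g)
         (h-mor : IsMorphism E D h) (h-onto : StrictlySurjective _≡_ h) where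

  private
    L : LeftAdjoint (h ∘ g)
    L = leftAdjoint icC (∘-isMorphism {f = g} {h} g-mor h-mor)
                        (∘-strictlySurjective {f = g} {h} g-onto h-onto)
    open LeftAdjoint L

  module _ (x : El C) (x∉φ : ¬ Image L x) where

    image-or-x : ∀ c → Image L c ⊎ c ≡ x
    image-or-x c with image? L c | c ≟El x
    ... | yes c∈φ | _       = inj₁ c∈φ
    ... | no  _   | yes c≡x = inj₂ c≡x
    ... | no  c∉φ | no  c≢x =
      ⊥-elim (⊎⊤↣⇒⊥ (Finite-⊎ (El-finite D) ⊤-finite) (↔⇒↣ C↔D⊤ ↣-∘ two-extra))
      where
      two-extra : ((El D ⊎ ⊤) ⊎ ⊤) ↣ El C
      two-extra = extend↣ (extend↣ (φ↣ L) x λ d φd≡x → x∉φ (d , φd≡x)) c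
                    [ (λ d φd≡c → c∉φ (d , φd≡c)) , (λ _ x≡c → c≢x (sym x≡c)) ]

    g-reflectsTrunks : ∃[ τ ] Pullback g τ (proj₁ x) → ReflectsTrunks g
    g-reflectsTrunks (τ , τ*) = reflectsTrunks {f = g} icC g*
      where
      g* : ∀ c → ∃[ σ ] Pullback g σ (proj₁ c)
      g* c with image-or-x c
      ... | inj₂ refl = τ , τ*
      ... | inj₁ (d , refl) with codeword-pullback {f = h} h-mor d
      ... | σ , σ* = σ , pullback-cancelˡ {f = g} {h} σ* (adjoint d)

    h-reflectsTrunks : ¬ (∃[ τ ] Pullback g τ (proj₁ x)) → ReflectsTrunks h
    h-reflectsTrunks ¬x-pulls σ σ-proper with g-mor σ σ-proper
    ... | σ′ , g* , ((c , σ′⊆c) , _) with trunk-least icC c σ′⊆c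
    ... | ĉ , σ′≐ĉ with image-or-x ĉ
    ... | inj₂ refl = ⊥-elim (¬x-pulls (σ , pullback-∘ {f = id} {g} g* σ′≐ĉ))
    ... | inj₁ (d , refl) = proj₁ d , pullback-cancelʳ {f = g} {h} g-onto
                              (pullback-∘ {f = id} {h ∘ g} (adjoint d) (pullback-id-sym σ′≐ĉ)) g*

  one-factor-is-iso : ¬ (C ≅ E) → ¬ (E ≅ D) → ⊥
  one-factor-is-iso C≇E E≇D with counterexample-or-all (El-finite C) (image? L)
  ... | inj₂ φ-onto =
    ⊎⊤↣⇒⊥ (El-finite D) (↔⇒↣ (φ-onto⇒↔ L φ-onto) ↣-∘ ↔⇒↣ (↔-sym C↔D⊤))
  ... | inj₁ (x , x∉φ) = ¬¬-excluded-middle λ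
          { (yes x-pulls) → C≇E (≅-from-reflecting g-mor g-onto (g-reflectsTrunks x x∉φ x-pulls))
          ; (no ¬x-pulls) → E≇D (≅-from-reflecting h-mor h-onto (h-reflectsTrunks x x∉φ ¬x-pulls)) }

no-code-between : ∀ {n m} {C : Code n} {D : Code m} → IntersectionComplete C → El C ↔ (El D ⊎ ⊤) →
                  ∀ {k} (E : Code k) → ¬ ((D <C E) × (E <C C))
no-code-between icC C↔D⊤ E (((h , h-mor , h-onto) , D≇E) , ((g , g-mor , g-onto) , E≇C)) =
  one-factor-is-iso icC C↔D⊤ g-mor g-onto h-mor h-onto (E≇C ∘ ≅-sym) (D≇E ∘ ≅-sym)

split⇒covers : ∀ {n m} {C : Code n} {D I : Code m} {μ : Subset m} →
               IntersectionComplete C → Isolated D I μ → C ≅ Split D I μ → Covers C D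
split⇒covers icC isolated C≅S =
  (≤C-respʳ-≅ C≅S D≤S , ¬≅-if-one-more C↔D⊤) , λ _ E _ → no-code-between icC C↔D⊤ E
  where
  open SplitCode isolated
  C↔D⊤ = ↔-trans (≅⇒↔ C≅S) El-Split↔

-- Covers are split codes

module CoverSplitting {n m} {C : Code n} {D : Code m}
         (icC : IntersectionComplete C) (icD : IntersectionComplete D)
         {f : El C → El D} (L : LeftAdjoint f) (x : El C) (x∉φ : ¬ Image L x)
         (x-maximal : ∀ y → ¬ Image L y → ¬ (proj₁ x ⊂ proj₁ y)) where
  open LeftAdjoint L
  open Equivalence

  μ : Subset m
  μ = proj₁ (f x)

  above-x : ∀ {y} → proj₁ x ⊆ proj₁ y → y ≢ x → φ (f y) ≡ y
  above-x {y} x⊆y y≢x with image? L y | proj₁ y ⊆? proj₁ x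
  ... | yes y∈φ | _       = image⇒φ∘f L y∈φ
  ... | no  _   | yes y⊆x = ⊥-elim (y≢x (El-≡ (⊆-antisym y⊆x x⊆y)))
  ... | no  y∉φ | no  y⊈x = ⊥-elim (x-maximal y y∉φ (⊆∧⊉⇒⊂ x⊆y y⊈x))

  UpperImage : Subset m → Set
  UpperImage c = ∃[ y ] (proj₁ x ⊆ proj₁ y × proj₁ (f y) ≡ c)

  upperImage? : ∀ c → Dec (UpperImage c)
  upperImage? c = any? (El-finite C) (λ y → (proj₁ x ⊆? proj₁ y) ×-dec (proj₁ (f y) ≟ˢ c))

  I : Code m
  I c = ⌊ upperImage? c ⌋

  ∈I⇔ : ∀ {c} → c ∈C I ⇔ UpperImage c
  ∈I⇔ = mk⇔ toWitness fromWitness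

  φ-above⇒∈I : ∀ d → proj₁ x ⊆ proj₁ (φ d) → proj₁ d ∈C I
  φ-above⇒∈I d x⊆φd = from ∈I⇔ (φ d , x⊆φd , cong proj₁ (f∘φ L d))

  ∈I⇒μ⊎φ-above : ∀ {c} → c ∈C I → (c∈D : c ∈C D) → c ≡ μ ⊎ proj₁ x ⊆ proj₁ (φ (c , c∈D))
  ∈I⇒μ⊎φ-above c∈I c∈D with to ∈I⇔ c∈I
  ... | y , x⊆y , refl with y ≟El x
  ... | yes refl = inj₁ refl
  ... | no  y≢x  = inj₂ (subst (λ y′ → proj₁ x ⊆ proj₁ y′) (sym φc≡y) x⊆y)
    where
    φc≡y : φ (_ , c∈D) ≡ y
    φc≡y = trans (cong φ (El-≡ refl)) (above-x x⊆y y≢x)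

  I⊆D : ∀ c → c ∈C I → c ∈C D
  I⊆D c c∈I with to ∈I⇔ c∈I
  ... | y , _ , refl = proj₂ (f y)

  μ∈I : μ ∈C I
  μ∈I = from ∈I⇔ (x , ⊆-refl , refl)

  μ-least : ∀ c → c ∈C I → μ ⊆ c
  μ-least c c∈I with to ∈I⇔ c∈I
  ... | y , x⊆y , refl = f-mono L x⊆y

  ∩-closed : ∀ c c′ → c ∈C I → c′ ∈C I → (c ∩ c′) ∈C I
  ∩-closed c c′ c∈I c′∈I
    with ∈I⇒μ⊎φ-above c∈I (I⊆D c c∈I) | ∈I⇒μ⊎φ-above c′∈I (I⊆D c′ c′∈I)
  ... | inj₁ refl | _         = subst (_∈C I) (sym (⊆⇒∩≡ˡ (μ-least c′ c′∈I))) c∈I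
  ... | inj₂ _    | inj₁ refl = subst (_∈C I) (sym (⊆⇒∩≡ʳ (μ-least c c∈I))) c′∈I
  ... | inj₂ x⊆φc | inj₂ x⊆φc′ = from ∈I⇔ (z , ⊆-∩ x⊆φc x⊆φc′ , f-∩ L icD z refl)
    where
    z : El C
    z = _ , icC _ _ (proj₂ (φ (c , I⊆D c c∈I))) (proj₂ (φ (c′ , I⊆D c′ c′∈I)))

  isolation : ∀ σ τ → σ ∈C D → ¬ σ ∈C I → τ ∈C I → τ ≢ μ → ¬ τ ⊆ σ
  isolation σ τ σ∈D σ∉I τ∈I τ≢μ τ⊆σ with ∈I⇒μ⊎φ-above τ∈I (I⊆D τ τ∈I)
  ... | inj₁ τ≡μ  = τ≢μ τ≡μ
  ... | inj₂ x⊆φτ = σ∉I (φ-above⇒∈I (σ , σ∈D) (⊆-trans x⊆φτ (φ-mono L τ⊆σ)))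

  isolated : Isolated D I μ
  isolated = record
    { I⊆D = I⊆D ; μ∈I = μ∈I ; ∩-closed = ∩-closed ; μ-least = μ-least ; isolation = isolation }

  open SplitCode isolated

  q-member : ∀ y → (does (proj₁ x ⊆? proj₁ y) ∷ proj₁ (f y)) ∈C S
  q-member y with proj₁ x ⊆? proj₁ y
  ... | yes x⊆y = from ∈I⇔ (y , x⊆y , refl)
  ... | no  x⊈y = from split-false⇔ (μ-or-outside (T? (I (proj₁ (f y)))))
    where
    μ-or-outside : Dec (proj₁ (f y) ∈C I) → proj₁ (f y) ≡ μ ⊎ (proj₁ (f y) ∈C D × ¬ proj₁ (f y) ∈C I)
    μ-or-outside (no fy∉I) = inj₂ (proj₂ (f y) , fy∉I)
    μ-or-outside (yes fy∈I) with ∈I⇒μ⊎φ-above fy∈I (proj₂ (f y))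
    ... | inj₁ fy≡μ   = inj₁ fy≡μ
    ... | inj₂ x⊆φfy = ⊥-elim (x⊈y (⊆-trans x⊆φfy (φ∘f⊆ L y)))

  q : El C → El S
  q y = (does (proj₁ x ⊆? proj₁ y) ∷ proj₁ (f y)) , q-member y

  x⊆φ : ∀ {c} (p : (true ∷ c) ∈C S) → c ≢ μ → proj₁ x ⊆ proj₁ (φ (π (true ∷ c , p)))
  x⊆φ {c} p c≢μ with ∈I⇒μ⊎φ-above p (I⊆D c p)
  ... | inj₁ c≡μ  = ⊥-elim (c≢μ c≡μ)
  ... | inj₂ x⊆φc = x⊆φc

  x⊈φ∘f : ¬ (proj₁ x ⊆ proj₁ (φ (f x)))
  x⊈φ∘f x⊆φfx = x∉φ (f x , El-≡ (⊆-antisym (φ∘f⊆ L x) x⊆φfx))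

  x⊈φ : ∀ {c} (p : (false ∷ c) ∈C S) → ¬ (proj₁ x ⊆ proj₁ (φ (π (false ∷ c , p))))
  x⊈φ p x⊆φc with to split-false⇔ p
  ... | inj₂ (_ , c∉I) = c∉I (φ-above⇒∈I _ x⊆φc)
  ... | inj₁ refl      = x⊈φ∘f (subst (λ d → proj₁ x ⊆ proj₁ (φ d)) (El-≡ refl) x⊆φc)

  ψ : El S → El C
  ψ (false ∷ c , p) = φ (π (false ∷ c , p))
  ψ (true  ∷ c , p) with c ≟ˢ μ
  ... | yes _ = x
  ... | no  _ = φ (π (true ∷ c , p))

  ψ-adjoint : ∀ w → Pullback q (proj₁ w) (proj₁ (ψ w))
  ψ-adjoint w@(false ∷ c , p) y = ⇔.trans (⇔.sym out⊆-⇔) (adjoint (π w) y)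
  ψ-adjoint w@(true ∷ c , p) y with c ≟ˢ μ | proj₁ x ⊆? proj₁ y
  ... | yes refl | yes x⊆y = both-⊆⇔ (in⊆in (f-mono L x⊆y)) x⊆y
  ... | yes refl | no  x⊈y = neither-⊆⇔ ¬in⊆out x⊈y
  ... | no  c≢μ  | yes _   = ⇔.trans (⇔.sym in⊆in-⇔) (adjoint (π w) y)
  ... | no  c≢μ  | no  x⊈y = neither-⊆⇔ ¬in⊆out (λ φc⊆y → x⊈y (⊆-trans (x⊆φ p c≢μ) φc⊆y))

  q∘ψ : ∀ w → q (ψ w) ≡ w
  q∘ψ w@(false ∷ c , p) = El-≡ (cong₂ _∷_ (dec-false (_ ⊆? _) (x⊈φ p)) (cong proj₁ (f∘φ L (π w))))
  q∘ψ w@(true ∷ c , p) with c ≟ˢ μ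
  ... | yes refl = El-≡ (cong (_∷ μ) (dec-true (proj₁ x ⊆? proj₁ x) ⊆-refl))
  ... | no  c≢μ  = El-≡ (cong₂ _∷_ (dec-true (_ ⊆? _) (x⊆φ p c≢μ)) (cong proj₁ (f∘φ L (π w))))

  ψ-leftAdjoint : LeftAdjoint q
  ψ-leftAdjoint = record { φ = ψ ; adjoint = ψ-adjoint ; f-surjective = λ w → ψ w , q∘ψ w }

  q-isMorphism : IsMorphism C S q
  q-isMorphism = f-isMorphism ψ-leftAdjoint (split-intersectionComplete icD)

  split-iso : IsNeuralCode D → (∀ k (E : Code k) → IsNeuralCode E → ¬ ((D <C E) × (E <C C))) → C ≅ S
  split-iso ∅∈D no-between with counterexample-or-all (El-finite C) (image? ψ-leftAdjoint)
  ... | inj₂ ψ-onto = φ-onto⇒≅ ψ-leftAdjoint q-isMorphism icC ψ-onto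
  ... | inj₁ (y , y∉ψ) = ⊥-elim (no-between _ S (split-neural ∅∈D) (D<S , S≤C , ¬image⇒≇ ψ-leftAdjoint y∉ψ))
    where
    S≤C : S ≤C C
    S≤C = q , q-isMorphism , LeftAdjoint.f-surjective ψ-leftAdjoint

covers⇒split : ∀ {n m} {C : Code n} {D : Code m} →
               IsNeuralCode D → IntersectionComplete C → IntersectionComplete D → Covers C D →
               Σ[ I ∈ Code m ] Σ[ μ ∈ Subset m ] (Isolated D I μ × (C ≅ Split D I μ))
covers⇒split {m = m} {C} {D} ∅∈D icC icD (((f , f-mor , f-onto) , D≇C) , no-between) =
  split (leftAdjoint icC f-mor f-onto)
  where
  split : LeftAdjoint f → Σ[ I ∈ Code m ] Σ[ μ ∈ Subset m ] (Isolated D I μ × (C ≅ Split D I μ))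
  split L with onto-or-maximal-outside L
  ... | inj₁ φ-onto = ⊥-elim (D≇C (≅-sym (φ-onto⇒≅ L f-mor icC φ-onto)))
  ... | inj₂ (x , x∉φ , x-maximal) = I , μ , isolated , split-iso ∅∈D no-between
    where open CoverSplitting icC icD L x x∉φ x-maximal

theorem40 : ∀ {n m} (C : Code n) (D : Code m) →
    IsNeuralCode C → IsNeuralCode D →
    IntersectionComplete C → IntersectionComplete D →
    Covers C D ⇔ (Σ[ I ∈ Code m ] Σ[ μ ∈ Subset m ] (Isolated D I μ × (C ≅ Split D I μ)))
theorem40 C D _ ∅∈D icC icD =
  mk⇔ (covers⇒split ∅∈D icC icD) (λ (_ , _ , isolated , C≅S) → split⇒covers icC isolated C≅S)
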